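{- Let $p, q$ be primes with $3 \leq p < q$ and $n = pq$. Then the total graph $T(\Gamma(\mathbb{Z}_n))$ is very cost effective.
   Context: $\mathbb{Z}_n$ is the ring of residue classes modulo $n$. The zero-divisor graph $\Gamma(\mathbb{Z}_n)$ has as vertices the nonzero zero-divisors of $\mathbb{Z}_n$, two distinct vertices $x,y$ being adjacent iff $xy = 0$. The total graph $T(G)$ of a graph $G$ has vertex set $V(G) \cup E(G)$, with two vertices adjacent iff they are adjacent vertices of $G$, or adjacent edges of $G$ (sharing an endpoint), or a vertex and an edge of $G$ incident to each other. For a graph $H=(V,E)$, $N(v)$ denotes the open neighborhood of $v$. Given $S \subseteq V$, a vertex $v \in S$ is very cost effective if $|N(v)\cap S| < |N(v) \cap (V\setminus S)|$; a set $S$ is very cost effective if every vertex of $S$ is very cost effective. A bipartition $\{S, V\setminus S\}$ is very cost effective if both parts are very cost effective sets, and $H$ is very cost effective if it has a very cost effective bipartition. -}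

module Defs where

open import Data.Bool using (Bool; true; false; _∧_; _∨_; not; if_then_else_)
open import Data.Nat using (ℕ; zero; suc; _*_; _<_; _≡ᵇ_; _%_)
open import Data.List using (List; []; _∷_; _++_; map; length; upTo)
open import Data.Bool.ListAction using (any)
open import Data.Product using (_×_; _,_; Σ)
open import Data.List.Membership.Propositional using (_∈_)
open import Relation.Binary.PropositionalEquality using (_≡_)

bfilter : {A : Set} → (A → Bool) → List A → List A
bfilter p []       = []
bfilter p (x ∷ xs) = if p x then x ∷ bfilter p xs else bfilter p xs

-- A finite simple graph: a carrier type, the (duplicate-free) list of its
-- vertices, decidable equality on the carrier, and a Boolean adjacency relation.
record Graph : Set₁ where
  field
    V     : Set
    verts : List V
    eqV   : V → V → Bool
    adj   : V → V → Bool
open Graph public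

pairs : {A : Set} → List A → List (A × A)
pairs []       = []
pairs (x ∷ xs) = map (x ,_) xs ++ pairs xs

-- edges of G, each listed once as an (unordered) pair of adjacent vertices
edges : (G : Graph) → List (V G × V G)
edges G = bfilter (λ e → adj G (Data.Product.proj₁ e) (Data.Product.proj₂ e)) (pairs (verts G))

shareEnd : (G : Graph) → V G × V G → V G × V G → Bool
shareEnd G (a , b) (c , d) = eqV G a c ∨ eqV G a d ∨ eqV G b c ∨ eqV G b d

sameEdge : (G : Graph) → V G × V G → V G × V G → Bool
sameEdge G (a , b) (c , d) = eqV G a c ∧ eqV G b d

data TV (G : Graph) : Set where
  vtx  : V G → TV G
  edge : V G × V G → TV G

tadj : (G : Graph) → TV G → TV G → Bool
tadj G (vtx u)  (vtx v)        = adj G u v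
tadj G (vtx u)  (edge (a , b)) = eqV G u a ∨ eqV G u b
tadj G (edge (a , b)) (vtx u)  = eqV G u a ∨ eqV G u b
tadj G (edge e) (edge f)       = not (sameEdge G e f) ∧ shareEnd G e f

tEq : (G : Graph) → TV G → TV G → Bool
tEq G (vtx u)  (vtx v)  = eqV G u v
tEq G (edge e) (edge f) = sameEdge G e f
tEq G _ _ = false

Total : Graph → Graph
Total G = record
  { V     = TV G
  ; verts = map vtx (verts G) ++ map edge (edges G)
  ; eqV   = tEq G
  ; adj   = tadj G
  }

-- zero-divisor graph Γ(ℤ_n): residues represented by 0 … n-1
isZeroDivisor : ℕ → ℕ → Bool
isZeroDivisor n x = not (x ≡ᵇ 0) ∧ any (λ y → not (y ≡ᵇ 0) ∧ ((x * y) % suc n' ≡ᵇ 0)) (upTo n)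
  where n' = Data.Nat.pred n

ZDGraph : ℕ → Graph
ZDGraph n = record
  { V     = ℕ
  ; verts = bfilter (isZeroDivisor n) (upTo n)
  ; eqV   = _≡ᵇ_
  ; adj   = λ x y → not (x ≡ᵇ y) ∧ ((x * y) % suc (Data.Nat.pred n) ≡ᵇ 0)
  }

countNbrsIn : (G : Graph) → (V G → Bool) → V G → ℕ
countNbrsIn G S v = length (bfilter (λ u → adj G v u ∧ S u) (verts G))

VeryCostEffectiveVertex : (G : Graph) → (V G → Bool) → V G → Set
VeryCostEffectiveVertex G S v =
  countNbrsIn G S v < countNbrsIn G (λ u → not (S u)) v

VeryCostEffectiveSet : (G : Graph) → (V G → Bool) → Set
VeryCostEffectiveSet G S =
  ∀ v → v ∈ verts G → S v ≡ true → VeryCostEffectiveVertex G S v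

VeryCostEffective : Graph → Set
VeryCostEffective G =
  Σ (V G → Bool) λ S →
    VeryCostEffectiveSet G S × VeryCostEffectiveSet G (λ u → not (S u))

module Submission where

-- Γ(ℤ_pq) is the complete bipartite graph between the nonzero multiples of p
-- and the nonzero multiples of q below n = pq.  Both parts have even size, so
-- each carries a parity-reversing injection; here x ↦ n ∸ x, which preserves
-- the part of x and flips its parity because n is odd.
--
-- If the same-side neighbours of v inject
--      into the other-side neighbours, missing one of them, then v is very cost
--      effective.  Such a witness is a "balancer"; a bipartition with a balancer
--      at every vertex is very cost effective (for an arbitrary graph).
--   2. Total graphs of complete bipartite graphs on ℕ-labelled vertices whose
--      parts carry an injection σ reversing a parity χ.  Colour a vertex by its
--      part and an edge {x , y} by χ x xor χ y (for Γ: the parity of x + y).  At a vertex u the same-side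
--      neighbours are edges {u , x}, sent to the vertex x; at an edge {a , b}
--      the same-side neighbours are one endpoint, sent to the other, and edges
--      {a , x} or {b , x}, sent to {a , σ x} resp. {b , σ x}.  The spare
--      opposite neighbour is an edge {u , y} of the right parity resp. {a , σ b}.
--   3. Γ(ℤ_pq) is such a graph, and the theorem follows.

open import Defs
open import Data.Bool using (Bool; true; false; not; _∧_; _∨_; _xor_; if_then_else_; T) renaming (_≟_ to _≟ᵇ_)
open import Data.Bool.Properties using (not-involutive; not-injective; not-¬; ∧-conicalˡ; ∧-conicalʳ; ∧-zeroʳ; ∨-zeroʳ; not-distribˡ-xor; xor-comm; xor-inverseˡ)
open import Data.Empty using (⊥; ⊥-elim)
open import Data.List using (List; []; _∷_; _++_; map; length; filter; upTo)
open import Data.List.Membership.Propositional using (_∈_; find; lose)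
open import Data.List.Relation.Binary.Subset.Propositional using (_⊆_)
open import Data.List.Membership.Propositional.Properties using (∈-filter⁺; ∈-filter⁻; ∈-++⁺ˡ; ∈-++⁺ʳ; ∈-++⁻; ∈-map⁺; ∈-map⁻; ∈-∃++; ∈-upTo⁺; ∈-upTo⁻)
open import Data.List.Properties using (length-map; length-++)
open import Data.List.Relation.Unary.All as All using (All; []; _∷_)
open import Data.List.Relation.Unary.AllPairs as AllPairs using (AllPairs; []; _∷_)
import Data.List.Relation.Unary.AllPairs.Properties as AllPairsₚ
open import Data.List.Relation.Unary.Any using (here; there)
open import Data.List.Relation.Unary.Any.Properties using (any⁺; any⁻)
open import Data.List.Relation.Unary.Unique.Propositional using (Unique)
import Data.List.Relation.Unary.Unique.Propositional.Properties as Uniqueₚ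
open import Data.Nat using (ℕ; zero; suc; _+_; _*_; _∸_; _≤_; _<_; _⊓_; _⊔_; _≡ᵇ_; _%_; z≤n; s≤s)
open import Data.Nat.Properties using (≡ᵇ⇒≡; ≡⇒≡ᵇ; +-suc; *-comm; <⇒≢; <⇒≤; <⇒≱; <-irrefl; <-asym; <-trans; ≤-trans; <-cmp; ≤-total; ⊓-comm; ⊔-comm; m≤n⇒m⊓n≡m; m≤n⇒m⊔n≡n; m≥n⇒m⊓n≡n; m≥n⇒m⊔n≡m; m<m*n; m+[n∸m]≡n; m∸[m∸n]≡n; m∸n≤m; m∸n+n≡m; m<n⇒0<n∸m; ∸-monoʳ-<; ∸-cancelˡ-≡; module ≤-Reasoning)
open import Data.Nat.Divisibility using (_∣_; divides; _∣?_; ∣-refl; ∣m∣n⇒∣m+n; ∣m+n∣m⇒∣n; ∣⇒≤; m%n≡0⇒n∣m; n∣m⇒m%n≡0; *-monoˡ-∣; *-pres-∣; m*n∣⇒m∣; m*n∣⇒n∣; m∣m*n; n∣m*n)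
open import Data.Nat.Primality using (Prime; euclidsLemma; prime⇒irreducible)
open import Data.Product using (_×_; _,_; proj₁; proj₂; ∃)
open import Data.Sum using (_⊎_; inj₁; inj₂; [_,_]; swap) renaming (map to map⊎)
open import Function using (_∘_)
open import Relation.Nullary using (¬_; yes; no; does)
open import Relation.Nullary.Decidable using (dec-true; dec-false)
open import Relation.Binary using (tri<; tri≈; tri>)
open import Relation.Binary.PropositionalEquality using (_≡_; _≢_; refl; sym; trans; cong; cong₂; subst; module ≡-Reasoning)

≡-across : ∀ {A : Set} {x x' y y' : A} → x ≡ x' → y ≡ y' → x ≡ y → x' ≡ y'
≡-across refl refl e = e

∧-intro : ∀ {a b} → a ≡ true → b ≡ true → a ∧ b ≡ true
∧-intro refl refl = refl

not-true : ∀ {a} → not a ≡ true → a ≡ false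
not-true {false} _ = refl

∨-introˡ : ∀ {a} b → a ≡ true → a ∨ b ≡ true
∨-introˡ b refl = refl

∨-introʳ : ∀ a {b} → b ≡ true → a ∨ b ≡ true
∨-introʳ a refl = ∨-zeroʳ a

∨-elim : ∀ {a b} → a ∨ b ≡ true → a ≡ true ⊎ b ≡ true
∨-elim {true}  _ = inj₁ refl
∨-elim {false} e = inj₂ e

≢not⇒≡ : ∀ {a b} → a ≢ not b → a ≡ b
≢not⇒≡ {true}  {true}  _ = refl
≢not⇒≡ {false} {false} _ = refl
≢not⇒≡ {true}  {false} n = ⊥-elim (n refl)
≢not⇒≡ {false} {true}  n = ⊥-elim (n refl)

xor-true : ∀ {a b} → a xor b ≡ true → a ≡ not b
xor-true {true}  {false} _ = refl
xor-true {false} {true}  _ = refl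

xor-cancelˡ : ∀ a {x y} → a xor x ≡ a xor y → x ≡ y
xor-cancelˡ true  e = not-injective e
xor-cancelˡ false e = e

xor-flipʳ : ∀ a {x y} → y ≡ not x → a xor y ≡ not (a xor x)
xor-flipʳ true  refl = refl
xor-flipʳ false refl = refl

T⇒≡true : ∀ {b} → T b → b ≡ true
T⇒≡true {true} _ = refl

≡true⇒T : ∀ {b} → b ≡ true → T b
≡true⇒T refl = _

≡ᵇ-true⁻ : ∀ {m n} → (m ≡ᵇ n) ≡ true → m ≡ n
≡ᵇ-true⁻ {m} {n} e = ≡ᵇ⇒≡ m n (≡true⇒T e)

≡ᵇ-intro : ∀ {m n} → m ≡ n → (m ≡ᵇ n) ≡ true
≡ᵇ-intro {m} {n} e = T⇒≡true (≡⇒≡ᵇ m n e)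

≡ᵇ-refl : ∀ n → (n ≡ᵇ n) ≡ true
≡ᵇ-refl n = ≡ᵇ-intro {n} refl

≡ᵇ-false : ∀ {m n} → m ≢ n → (m ≡ᵇ n) ≡ false
≡ᵇ-false {m} {n} m≢n with m ≡ᵇ n in e
... | true  = ⊥-elim (m≢n (≡ᵇ-true⁻ e))
... | false = refl

-- The Boolean filter of Defs agrees with the library's filter, which
-- gives access to its membership, sortedness and uniqueness lemmas.
module BoolFilter {A : Set} (P : A → Bool) where

  bfilter≡filter : ∀ xs → bfilter P xs ≡ filter (λ x → P x ≟ᵇ true) xs
  bfilter≡filter []       = refl
  bfilter≡filter (x ∷ xs) with P x
  ... | true  = cong (x ∷_) (bfilter≡filter xs)
  ... | false = bfilter≡filter xs

  ∈-bfilter⁻ : ∀ {x xs} → x ∈ bfilter P xs → x ∈ xs × P x ≡ true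
  ∈-bfilter⁻ {x} {xs} m = ∈-filter⁻ (λ y → P y ≟ᵇ true) (subst (x ∈_) (bfilter≡filter xs) m)

  ∈-bfilter⁺ : ∀ {x xs} → x ∈ xs → P x ≡ true → x ∈ bfilter P xs
  ∈-bfilter⁺ {x} {xs} m px = subst (x ∈_) (sym (bfilter≡filter xs)) (∈-filter⁺ (λ y → P y ≟ᵇ true) m px)

  bfilter-AllPairs : ∀ {R : A → A → Set} {xs} → AllPairs R xs → AllPairs R (bfilter P xs)
  bfilter-AllPairs {R} {xs} s = subst (AllPairs R) (sym (bfilter≡filter xs)) (AllPairsₚ.filter⁺ _ s)

open BoolFilter

module Counting {A : Set} where

  unique-⊆-length : ∀ {xs ys : List A} → Unique xs → xs ⊆ ys → length xs ≤ length ys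
  unique-⊆-length {[]}     _           _   = z≤n
  unique-⊆-length {x ∷ xs} (x∉xs ∷ u) sub with ∈-∃++ (sub (here refl))
  ... | us , vs , refl = begin
      suc (length xs)              ≤⟨ s≤s (unique-⊆-length u drop-x) ⟩
      suc (length (us ++ vs))      ≡⟨ cong suc (length-++ us) ⟩
      suc (length us + length vs)  ≡⟨ sym (+-suc (length us) (length vs)) ⟩
      length us + length (x ∷ vs)  ≡⟨ sym (length-++ us) ⟩
      length (us ++ x ∷ vs)        ∎
    where
      open ≤-Reasoning
      -- every element of xs differs from x, so it survives removing x from ys
      drop-x : xs ⊆ us ++ vs
      drop-x {z} z∈xs with ∈-++⁻ us (sub (there z∈xs))
      ... | inj₁ z∈us         = ∈-++⁺ˡ z∈us
      ... | inj₂ (there z∈vs) = ∈-++⁺ʳ us z∈vs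
      ... | inj₂ (here refl)  = ⊥-elim (All.lookup x∉xs z∈xs refl)

  map-unique : (f : A → A) {ys : List A} → Unique ys →
               (∀ {x y} → x ∈ ys → y ∈ ys → f x ≡ f y → x ≡ y) → Unique (map f ys)
  map-unique f {[]}     _          _   = []
  map-unique f {y ∷ ys} (y∉ys ∷ u) inj =
    All.tabulate (λ {z} z∈fys fy≡z → distinct z∈fys fy≡z)
    ∷ map-unique f u (λ x∈ y∈ → inj (there x∈) (there y∈))
    where
      distinct : ∀ {z} → z ∈ map f ys → f y ≢ z
      distinct z∈fys fy≡z with ∈-map⁻ f z∈fys
      ... | w , w∈ys , refl = All.lookup y∉ys w∈ys (inj (here refl) (there w∈ys) fy≡z)

  fewer-by-injection :
    ∀ {xs : List A} (P Q : A → Bool) (f : A → A) (z : A) → Unique xs →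
    (∀ {x} → x ∈ xs → P x ≡ true → f x ∈ xs × Q (f x) ≡ true) →
    (∀ {x y} → x ∈ xs → y ∈ xs → P x ≡ true → P y ≡ true → f x ≡ f y → x ≡ y) →
    z ∈ xs → Q z ≡ true → (∀ {x} → x ∈ xs → P x ≡ true → f x ≢ z) →
    length (bfilter P xs) < length (bfilter Q xs)
  fewer-by-injection {xs} P Q f z u maps inj z∈ Qz new =
    subst (_≤ length (bfilter Q xs)) (cong suc (length-map f (bfilter P xs)))
      (unique-⊆-length (z∉image ∷ image-unique) into-Q)
    where
      image-unique : Unique (map f (bfilter P xs))
      image-unique = map-unique f (bfilter-AllPairs P u) λ x∈ y∈ →
        let (x∈xs , Px) = ∈-bfilter⁻ P x∈ ; (y∈xs , Py) = ∈-bfilter⁻ P y∈ in inj x∈xs y∈xs Px Py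
      z∉image : All (z ≢_) (map f (bfilter P xs))
      z∉image = All.tabulate λ w∈ z≡w → missed (∈-map⁻ f w∈) z≡w
        where
          missed : ∀ {w} → ∃ (λ x → x ∈ bfilter P xs × w ≡ f x) → z ≢ w
          missed (x , x∈ , refl) z≡fx = let (x∈xs , Px) = ∈-bfilter⁻ P x∈ in new x∈xs Px (sym z≡fx)
      into-Q : z ∷ map f (bfilter P xs) ⊆ bfilter Q xs
      into-Q (here refl) = ∈-bfilter⁺ Q z∈ Qz
      into-Q (there w∈) with ∈-map⁻ f w∈
      ... | x , x∈ , refl = let (x∈xs , Px) = ∈-bfilter⁻ P x∈ ; (fx∈ , Qfx) = maps x∈xs Px in ∈-bfilter⁺ Q fx∈ Qfx

open Counting

module Balancing (G : Graph) (S : V G → Bool) where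

  SameSideNbr OtherSideNbr : V G → V G → Set
  SameSideNbr  v w = w ∈ verts G × adj G v w ≡ true × S w ≡ S v
  OtherSideNbr v w = w ∈ verts G × adj G v w ≡ true × S w ≡ not (S v)

  record Balancer (v : V G) : Set where
    field
      f         : V G → V G
      f-maps    : ∀ {w} → SameSideNbr v w → OtherSideNbr v (f w)
      f-inj     : ∀ {w w'} → SameSideNbr v w → SameSideNbr v w' → f w ≡ f w' → w ≡ w'
      spare     : V G
      spare-nbr : OtherSideNbr v spare
      spare-new : ∀ {w} → SameSideNbr v w → f w ≢ spare

  balanced-vertex : Unique (verts G) → ∀ {v} → Balancer v → (R : V G → Bool) →
    (∀ {u} → R u ≡ true → S u ≡ S v) → (∀ {u} → S u ≡ not (S v) → R u ≡ false) →
    VeryCostEffectiveVertex G R v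
  balanced-vertex uniq {v} bal R R⇒same other⇒¬R =
    fewer-by-injection P Q f spare uniq maps inj (proj₁ spare-nbr) (toQ spare-nbr) new
    where
      open Balancer bal
      P Q : V G → Bool
      P u = adj G v u ∧ R u
      Q u = adj G v u ∧ not (R u)
      fromP : ∀ {u} → u ∈ verts G → P u ≡ true → SameSideNbr v u
      fromP {u} u∈ Pu = u∈ , ∧-conicalˡ _ _ Pu , R⇒same (∧-conicalʳ (adj G v u) _ Pu)
      toQ : ∀ {u} → OtherSideNbr v u → Q u ≡ true
      toQ (_ , vu , Su) = ∧-intro vu (cong not (other⇒¬R Su))
      maps : ∀ {u} → u ∈ verts G → P u ≡ true → f u ∈ verts G × Q (f u) ≡ true
      maps u∈ Pu = let o = f-maps (fromP u∈ Pu) in proj₁ o , toQ o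
      inj : ∀ {x y} → x ∈ verts G → y ∈ verts G → P x ≡ true → P y ≡ true → f x ≡ f y → x ≡ y
      inj x∈ y∈ Px Py = f-inj (fromP x∈ Px) (fromP y∈ Py)
      new : ∀ {u} → u ∈ verts G → P u ≡ true → f u ≢ spare
      new u∈ Pu = spare-new (fromP u∈ Pu)

  balanced⇒veryCostEffective : Unique (verts G) → (∀ {v} → v ∈ verts G → Balancer v) →
    VeryCostEffective G
  balanced⇒veryCostEffective uniq bal = S , inS , inComplement
    where
      inS : VeryCostEffectiveSet G S
      inS v v∈ Sv = balanced-vertex uniq (bal v∈) S
        (λ Su → trans Su (sym Sv)) (λ Su → trans Su (cong not Sv))
      inComplement : VeryCostEffectiveSet G (λ u → not (S u))
      inComplement v v∈ ¬Sv = balanced-vertex uniq (bal v∈) (λ u → not (S u))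
        (λ ¬Su → trans (not-true ¬Su) (sym (not-true ¬Sv)))
        (λ Su → trans (cong not Su) (trans (not-involutive _) (not-true ¬Sv)))

module Pairs {A : Set} where

  ∈-pairs⁻ : ∀ {R : A → A → Set} {xs x y} → AllPairs R xs → (x , y) ∈ pairs xs →
             x ∈ xs × y ∈ xs × R x y
  ∈-pairs⁻ {xs = z ∷ zs} (z≺zs ∷ s) m with ∈-++⁻ (map (z ,_) zs) m
  ... | inj₁ m₁ with ∈-map⁻ (z ,_) m₁
  ...   | w , w∈ , refl = here refl , there w∈ , All.lookup z≺zs w∈
  ∈-pairs⁻ {xs = z ∷ zs} (_ ∷ s) m | inj₂ m₂ =
    let (x∈ , y∈ , r) = ∈-pairs⁻ s m₂ in there x∈ , there y∈ , r

  pairs-unique : ∀ {xs} → Unique xs → Unique (pairs xs)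
  pairs-unique {[]}     _          = []
  pairs-unique {z ∷ zs} (z∉zs ∷ u) =
    Uniqueₚ.++⁺ (Uniqueₚ.map⁺ (λ { refl → refl }) u) (pairs-unique u) disjoint
    where
      disjoint : ∀ {e} → ¬ (e ∈ map (z ,_) zs × e ∈ pairs zs)
      disjoint (m₁ , m₂) with ∈-map⁻ (z ,_) m₁
      ... | w , _ , refl = All.lookup z∉zs (proj₁ (∈-pairs⁻ u m₂)) refl

open Pairs

∈-pairs⁺ : ∀ {xs x y} → AllPairs _<_ xs → x ∈ xs → y ∈ xs → x < y → (x , y) ∈ pairs xs
∈-pairs⁺ {z ∷ zs} _         (here refl) (here refl) x<y = ⊥-elim (<-irrefl refl x<y)
∈-pairs⁺ {z ∷ zs} _         (here refl) (there y∈)  _   = ∈-++⁺ˡ (∈-map⁺ (z ,_) y∈)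
∈-pairs⁺ {z ∷ zs} (z< ∷ _) (there x∈)  (here refl) x<y = ⊥-elim (<-asym x<y (All.lookup z< x∈))
∈-pairs⁺ {z ∷ zs} (_ ∷ s)  (there x∈)  (there y∈)  x<y = ∈-++⁺ʳ (map (z ,_) zs) (∈-pairs⁺ s x∈ y∈ x<y)

-- The canonical (increasing) listing of the unordered pair {a , b}, and its endpoints.
mk : ℕ → ℕ → ℕ × ℕ
mk a b = a ⊓ b , a ⊔ b

mk-comm : ∀ a b → mk a b ≡ mk b a
mk-comm a b = cong₂ _,_ (⊓-comm a b) (⊔-comm a b)

mk-< : ∀ {a b} → a < b → mk a b ≡ (a , b)
mk-< a<b = cong₂ _,_ (m≤n⇒m⊓n≡m (<⇒≤ a<b)) (m≤n⇒m⊔n≡n (<⇒≤ a<b))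

mk-cases : ∀ a b → mk a b ≡ (a , b) ⊎ mk a b ≡ (b , a)
mk-cases a b with ≤-total a b
... | inj₁ a≤b = inj₁ (cong₂ _,_ (m≤n⇒m⊓n≡m a≤b) (m≤n⇒m⊔n≡n a≤b))
... | inj₂ b≤a = inj₂ (cong₂ _,_ (m≥n⇒m⊓n≡n b≤a) (m≥n⇒m⊔n≡m b≤a))

Ends : ℕ × ℕ → ℕ → Set
Ends (x , y) u = u ≡ x ⊎ u ≡ y

ends-mk⁺ : ∀ {a b u} → u ≡ a ⊎ u ≡ b → Ends (mk a b) u
ends-mk⁺ {a} {b} {u} h with mk-cases a b
... | inj₁ e = subst (λ f → Ends f u) (sym e) h
... | inj₂ e = subst (λ f → Ends f u) (sym e) (swap h)

ends-mk⁻ : ∀ {a b u} → Ends (mk a b) u → u ≡ a ⊎ u ≡ b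
ends-mk⁻ {a} {b} {u} h with mk-cases a b
... | inj₁ e = subst (λ f → Ends f u) e h
... | inj₂ e = swap (subst (λ f → Ends f u) e h)

ends-shared : ∀ {a b c d} → mk a b ≡ mk c d → a ≡ c ⊎ a ≡ d
ends-shared e = ends-mk⁻ (subst (λ f → Ends f _) e (ends-mk⁺ (inj₁ refl)))

mk-injʳ : ∀ {a x y} → x ≢ a → mk a x ≡ mk a y → x ≡ y
mk-injʳ {a} {x} {y} x≢a e with ends-shared (trans (mk-comm x a) e)
... | inj₁ x≡a = ⊥-elim (x≢a x≡a)
... | inj₂ x≡y = x≡y

-- Total graphs of complete bipartite graphs with parity-reversing parts.
module CompleteBipartite
  (L : List ℕ) (L-sorted : AllPairs _<_ L)
  (adjK : ℕ → ℕ → Bool) (side : ℕ → Bool)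
  (adjK-side : ∀ {x y} → x ∈ L → y ∈ L → adjK x y ≡ side x xor side y)
  (χ : ℕ → Bool) (σ : ℕ → ℕ)
  (σ-∈ : ∀ {x} → x ∈ L → σ x ∈ L)
  (σ-side : ∀ {x} → x ∈ L → side (σ x) ≡ side x)
  (σ-χ : ∀ {x} → x ∈ L → χ (σ x) ≡ not (χ x))
  (σ-inj : ∀ {x y} → x ∈ L → y ∈ L → σ x ≡ σ y → x ≡ y)
  (opposite : ∀ {x} → x ∈ L → ∃ λ y → y ∈ L × side y ≡ not (side x))
  where

  K : Graph
  K = record { V = ℕ ; verts = L ; eqV = _≡ᵇ_ ; adj = adjK }

  TK : Graph
  TK = Total K

  Link : ℕ → ℕ → Set
  Link a b = a ∈ L × b ∈ L × side a ≡ not (side b)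

  link-sym : ∀ {a b} → Link a b → Link b a
  link-sym {a} {b} (a∈ , b∈ , o) = b∈ , a∈ , trans (sym (not-involutive (side b))) (cong not (sym o))

  link-≢ : ∀ {a b} → Link a b → a ≢ b
  link-≢ (_ , _ , o) refl = not-¬ refl o

  link-adj : ∀ {a b} → Link a b → adjK a b ≡ true
  link-adj {a} {b} (a∈ , b∈ , o) =
    trans (adjK-side a∈ b∈) (trans (cong (_xor side b) o) (xor-inverseˡ (side b)))

  adj⇒link : ∀ {a b} → a ∈ L → b ∈ L → adjK a b ≡ true → Link a b
  adj⇒link a∈ b∈ e = a∈ , b∈ , xor-true (trans (sym (adjK-side a∈ b∈)) e)

  link-σ : ∀ {a x} → Link a x → Link a (σ x)
  link-σ (a∈ , x∈ , o) = a∈ , σ-∈ x∈ , trans o (cong not (sym (σ-side x∈)))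

  edgeTest : ℕ × ℕ → Bool
  edgeTest e = adjK (proj₁ e) (proj₂ e)

  edge-∈⁺< : ∀ {a b} → a < b → Link a b → mk a b ∈ edges K
  edge-∈⁺< a<b l@(a∈ , b∈ , _) = subst (_∈ edges K) (sym (mk-< a<b))
    (∈-bfilter⁺ edgeTest (∈-pairs⁺ L-sorted a∈ b∈ a<b) (link-adj l))

  edge-∈⁺ : ∀ {a b} → Link a b → mk a b ∈ edges K
  edge-∈⁺ {a} {b} l with <-cmp a b
  ... | tri< a<b _ _ = edge-∈⁺< a<b l
  ... | tri≈ _ a≡b _ = ⊥-elim (link-≢ l a≡b)
  ... | tri> _ _ b<a = subst (_∈ edges K) (mk-comm b a) (edge-∈⁺< b<a (link-sym l))

  edge-∈⁻ : ∀ {e} → e ∈ edges K → ∃ λ a → ∃ λ b → Link a b × e ≡ mk a b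
  edge-∈⁻ {x , y} e∈ with ∈-bfilter⁻ edgeTest e∈
  ... | e∈pairs , adjacent with ∈-pairs⁻ L-sorted e∈pairs
  ...   | x∈ , y∈ , x<y = x , y , adj⇒link x∈ y∈ adjacent , sym (mk-< x<y)

  data TVertex : TV K → Set where
    vertex : ∀ {x} → x ∈ L → TVertex (vtx x)
    edgeOf : ∀ {a b} → Link a b → TVertex (edge (mk a b))

  classify : ∀ {w} → w ∈ verts TK → TVertex w
  classify w∈ with ∈-++⁻ (map vtx L) w∈
  ... | inj₁ w∈V with ∈-map⁻ vtx w∈V
  ...   | x , x∈ , refl = vertex x∈
  classify w∈ | inj₂ w∈E with ∈-map⁻ edge w∈E
  ...   | e , e∈ , refl with edge-∈⁻ e∈
  ...     | a , b , l , refl = edgeOf l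

  vtx-∈ : ∀ {x} → x ∈ L → vtx x ∈ verts TK
  vtx-∈ x∈ = ∈-++⁺ˡ (∈-map⁺ vtx x∈)

  edge-∈ : ∀ {a b} → Link a b → edge (mk a b) ∈ verts TK
  edge-∈ l = ∈-++⁺ʳ (map vtx L) (∈-map⁺ edge (edge-∈⁺ l))

  vtx-injective : ∀ {x y} → vtx {K} x ≡ vtx y → x ≡ y
  vtx-injective refl = refl

  edge-injective : ∀ {e f} → edge {K} e ≡ edge f → e ≡ f
  edge-injective refl = refl

  TK-unique : Unique (verts TK)
  TK-unique = Uniqueₚ.++⁺
    (Uniqueₚ.map⁺ vtx-injective (AllPairs.map <⇒≢ L-sorted))
    (Uniqueₚ.map⁺ edge-injective (bfilter-AllPairs edgeTest (pairs-unique (AllPairs.map <⇒≢ L-sorted))))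
    (λ (v∈V , v∈E) → vertex≢edge v∈V v∈E)
    where
      vertex≢edge : ∀ {w} → w ∈ map vtx L → w ∈ map edge (edges K) → ⊥
      vertex≢edge v∈V v∈E with ∈-map⁻ vtx v∈V | ∈-map⁻ edge v∈E
      ... | _ , _ , refl | _ , _ , ()

  incident⁺ : ∀ {u e} → Ends e u → tadj K (vtx u) (edge e) ≡ true
  incident⁺ {u} {x , y} (inj₁ u≡x) = ∨-introˡ (u ≡ᵇ y) (≡ᵇ-intro u≡x)
  incident⁺ {u} {x , y} (inj₂ u≡y) = ∨-introʳ (u ≡ᵇ x) (≡ᵇ-intro u≡y)

  incident⁻ : ∀ {u e} → tadj K (vtx u) (edge e) ≡ true → Ends e u
  incident⁻ t = map⊎ ≡ᵇ-true⁻ ≡ᵇ-true⁻ (∨-elim t)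

  incident-false : ∀ {u e} → ¬ Ends e u → tadj K (vtx u) (edge e) ≡ false
  incident-false {u} {e} ¬ends with tadj K (vtx u) (edge e) in t
  ... | true  = ⊥-elim (¬ends (incident⁻ {e = e} t))
  ... | false = refl

  sameEdge⁻ : ∀ e f → sameEdge K e f ≡ true → e ≡ f
  sameEdge⁻ (x , y) (z , w) s =
    cong₂ _,_ (≡ᵇ-true⁻ (∧-conicalˡ _ _ s)) (≡ᵇ-true⁻ (∧-conicalʳ (x ≡ᵇ z) _ s))

  sameEdge-refl : ∀ e → sameEdge K e e ≡ true
  sameEdge-refl (x , y) = ∧-intro (≡ᵇ-refl x) (≡ᵇ-refl y)

  shareEnd⁺ : ∀ {u} e f → Ends e u → Ends f u → shareEnd K e f ≡ true
  shareEnd⁺ (x , y) (z , w) (inj₁ refl) (inj₁ refl) = ∨-introˡ _ (≡ᵇ-refl x)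
  shareEnd⁺ (x , y) (z , w) (inj₁ refl) (inj₂ refl) =
    ∨-introʳ (x ≡ᵇ z) (∨-introˡ _ (≡ᵇ-refl x))
  shareEnd⁺ (x , y) (z , w) (inj₂ refl) (inj₁ refl) =
    ∨-introʳ (x ≡ᵇ z) (∨-introʳ (x ≡ᵇ w) (∨-introˡ _ (≡ᵇ-refl y)))
  shareEnd⁺ (x , y) (z , w) (inj₂ refl) (inj₂ refl) =
    ∨-introʳ (x ≡ᵇ z) (∨-introʳ (x ≡ᵇ w) (∨-introʳ (y ≡ᵇ z) (≡ᵇ-refl y)))

  shareEnd⁻ : ∀ e f → shareEnd K e f ≡ true → ∃ λ u → Ends e u × Ends f u
  shareEnd⁻ (x , y) (z , w) s with ∨-elim s
  ... | inj₁ x≡z = x , inj₁ refl , inj₁ (≡ᵇ-true⁻ x≡z)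
  ... | inj₂ s' with ∨-elim s'
  ...   | inj₁ x≡w = x , inj₁ refl , inj₂ (≡ᵇ-true⁻ x≡w)
  ...   | inj₂ s'' with ∨-elim s''
  ...     | inj₁ y≡z = y , inj₂ refl , inj₁ (≡ᵇ-true⁻ y≡z)
  ...     | inj₂ y≡w = y , inj₂ refl , inj₂ (≡ᵇ-true⁻ y≡w)

  edge-adj⁺ : ∀ {e f u} → e ≢ f → Ends e u → Ends f u → tadj K (edge e) (edge f) ≡ true
  edge-adj⁺ {e} {f} e≢f eu fu with sameEdge K e f in s
  ... | true  = ⊥-elim (e≢f (sameEdge⁻ e f s))
  ... | false = shareEnd⁺ e f eu fu

  edge-adj⁻ : ∀ {e f} → tadj K (edge e) (edge f) ≡ true → e ≢ f × ∃ λ u → Ends e u × Ends f u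
  edge-adj⁻ {e} {f} t = distinct , shareEnd⁻ e f (∧-conicalʳ (not (sameEdge K e f)) _ t)
    where
      distinct : e ≢ f
      distinct refl with () ← trans (sym (sameEdge-refl e)) (not-true (∧-conicalˡ _ _ t))

  reroot : ∀ {c d u} → Link c d → Ends (mk c d) u → ∃ λ y → Link u y × mk c d ≡ mk u y
  reroot {c} {d} l h with ends-mk⁻ h
  ... | inj₁ refl = d , l , refl
  ... | inj₂ refl = c , link-sym l , mk-comm c d

  data VertexNbr (u : ℕ) : TV K → Set where
    nbr-vtx  : ∀ {x} → Link u x → VertexNbr u (vtx x)
    nbr-edge : ∀ {x} → Link u x → VertexNbr u (edge (mk u x))

  vertexNbr : ∀ {u w} → u ∈ L → w ∈ verts TK → tadj K (vtx u) w ≡ true → VertexNbr u w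
  vertexNbr u∈ w∈ t with classify w∈
  ... | vertex x∈ = nbr-vtx (adj⇒link u∈ x∈ t)
  ... | edgeOf {a} {b} l with reroot l (incident⁻ {e = mk a b} t)
  ...   | y , l' , e = subst (VertexNbr _ ∘ edge) (sym e) (nbr-edge l')

  data EdgeNbr (a b : ℕ) : TV K → Set where
    end₁   : EdgeNbr a b (vtx a)
    end₂   : EdgeNbr a b (vtx b)
    along₁ : ∀ {x} → Link a x → x ≢ b → EdgeNbr a b (edge (mk a x))
    along₂ : ∀ {x} → Link b x → x ≢ a → EdgeNbr a b (edge (mk b x))

  edgeNbr : ∀ {a b w} → w ∈ verts TK → tadj K (edge (mk a b)) w ≡ true → EdgeNbr a b w
  edgeNbr {a} {b} w∈ t with classify w∈
  ... | vertex {x} _ with ends-mk⁻ (incident⁻ {x} {mk a b} t)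
  ...   | inj₁ refl = end₁
  ...   | inj₂ refl = end₂
  edgeNbr {a} {b} w∈ t | edgeOf l with edge-adj⁻ {mk a b} t
  ... | distinct , u , at-ab , at-w with reroot l at-w | ends-mk⁻ {a} {b} at-ab
  ...   | y , l' , e | inj₁ refl =
          subst (EdgeNbr a b ∘ edge) (sym e) (along₁ l' λ { refl → distinct (sym e) })
  ...   | y , l' , e | inj₂ refl =
          subst (EdgeNbr a b ∘ edge) (sym e) (along₂ l' λ { refl → distinct (trans (mk-comm a b) (sym e)) })

  S : TV K → Bool
  S (vtx x)        = side x
  S (edge (x , y)) = χ x xor χ y

  S-mk : ∀ a b → S (edge (mk a b)) ≡ χ a xor χ b
  S-mk a b with mk-cases a b
  ... | inj₁ e = cong (S ∘ edge) e
  ... | inj₂ e = trans (cong (S ∘ edge) e) (xor-comm (χ b) (χ a))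

  open Balancing TK S

  reverse : ∀ {a b w} → OtherSideNbr (edge (mk b a)) w → OtherSideNbr (edge (mk a b)) w
  reverse {a} {b} {w} = subst (λ e → OtherSideNbr (edge e) w) (mk-comm b a)

  other : ℕ → ℕ × ℕ → ℕ
  other u (x , y) = if x ≡ᵇ u then y else x

  other-mk : ∀ {u x} → Link u x → other u (mk u x) ≡ x
  other-mk {u} {x} l with mk-cases u x
  ... | inj₁ e = trans (cong (other u) e) (cong (if_then x else u) (≡ᵇ-refl u))
  ... | inj₂ e = trans (cong (other u) e) (cong (if_then u else x) (≡ᵇ-false (link-≢ (link-sym l))))

  vertex-across : ∀ {u x} → Link u x → OtherSideNbr (vtx u) (vtx x)
  vertex-across l@(_ , x∈ , _) = vtx-∈ x∈ , link-adj l , proj₂ (proj₂ (link-sym l))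

  -- an edge {u , y} on the side opposite to u: y or σ y for any y across from u
  spareEnd : ∀ {u} → u ∈ L → ∃ λ y → Link u y × χ u xor χ y ≡ not (side u)
  spareEnd {u} u∈ with opposite u∈
  ... | y , y∈ , o = choose (link-sym (y∈ , u∈ , o))
    where
      choose : Link u y → ∃ λ y' → Link u y' × χ u xor χ y' ≡ not (side u)
      choose l with χ u xor χ y ≟ᵇ not (side u)
      ... | yes same  = y , l , same
      ... | no differ = σ y , link-σ l , trans (xor-flipʳ (χ u) (σ-χ y∈)) (cong not (≢not⇒≡ differ))

  -- At a vertex u the same-side neighbours are the edges {u , x}; send them to x.
  vertexBalancer : ∀ {u} → u ∈ L → Balancer (vtx u)
  vertexBalancer {u} u∈ with spareEnd u∈
  ... | y , l , colour = record
    { f = λ w → vtx (far w) ; f-maps = maps ; f-inj = inj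
    ; spare = edge (mk u y)
    ; spare-nbr = edge-∈ l , incident⁺ {u} {mk u y} (ends-mk⁺ (inj₁ refl)) , trans (S-mk u y) colour
    ; spare-new = λ _ () }
    where
      -- no vertex of K is on u's side, so vertices may be sent anywhere
      far : TV K → ℕ
      far (vtx x)  = x
      far (edge e) = other u e

      same-side-edge : ∀ {w} → SameSideNbr (vtx u) w → ∃ λ x → Link u x × w ≡ edge (mk u x)
      same-side-edge (w∈ , t , s) with vertexNbr u∈ w∈ t
      ... | nbr-vtx (_ , _ , o) = ⊥-elim (not-¬ (sym s) o)
      ... | nbr-edge lx         = _ , lx , refl

      maps : ∀ {w} → SameSideNbr (vtx u) w → OtherSideNbr (vtx u) (vtx (far w))
      maps s with same-side-edge s
      ... | x , lx , refl = subst (OtherSideNbr (vtx u) ∘ vtx) (sym (other-mk lx)) (vertex-across lx)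

      inj : ∀ {w w'} → SameSideNbr (vtx u) w → SameSideNbr (vtx u) w' → vtx (far w) ≡ vtx (far w') → w ≡ w'
      inj s s' e with same-side-edge s | same-side-edge s'
      ... | x , lx , refl | x' , lx' , refl =
        cong (edge ∘ mk u) (trans (sym (other-mk lx)) (trans (vtx-injective e) (other-mk lx')))

  row-flip : ∀ {a b x} → Link a b → Link a x → χ x ≡ χ b →
             OtherSideNbr (edge (mk a b)) (edge (mk a (σ x)))
  row-flip {a} {b} {x} lab lax@(_ , x∈ , _) χx≡χb =
    edge-∈ (link-σ lax) , edge-adj⁺ distinct (ends-mk⁺ (inj₁ refl)) (ends-mk⁺ (inj₁ refl)) , colour
    where
      χσx≡¬χb : χ (σ x) ≡ not (χ b)
      χσx≡¬χb = trans (σ-χ x∈) (cong not χx≡χb)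
      distinct : mk a b ≢ mk a (σ x)
      distinct e = not-¬ refl (trans (cong χ (mk-injʳ (link-≢ (link-sym lab)) e)) χσx≡¬χb)
      colour : S (edge (mk a (σ x))) ≡ not (S (edge (mk a b)))
      colour = begin
        S (edge (mk a (σ x)))  ≡⟨ S-mk a (σ x) ⟩
        χ a xor χ (σ x)        ≡⟨ xor-flipʳ (χ a) χσx≡¬χb ⟩
        not (χ a xor χ b)      ≡⟨ cong not (sym (S-mk a b)) ⟩
        not (S (edge (mk a b))) ∎
        where open ≡-Reasoning

  end-flip : ∀ {a b} → Link a b → S (vtx a) ≡ S (edge (mk a b)) →
             OtherSideNbr (edge (mk a b)) (vtx b)
  end-flip {a} {b} l s =
    vtx-∈ (proj₁ (proj₂ l)) , incident⁺ {b} {mk a b} (ends-mk⁺ (inj₂ refl)) ,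
    trans (proj₂ (proj₂ (link-sym l))) (cong not s)

  -- At an edge {a , b}: swap the endpoints, and replace the far end x of a
  -- neighbouring edge at a (resp. b) by σ x.  The edge {a , σ b} is spare.
  module EdgeBalancer {a b} (l : Link a b) where

    v : TV K
    v = edge (mk a b)

    -- on edges, the test is whether the edge contains a
    f : TV K → TV K
    f (vtx x)  = vtx (if x ≡ᵇ a then b else a)
    f (edge e) = edge (if tadj K (vtx a) (edge e) then mk a (σ (other a e)) else mk b (σ (other b e)))

    nbr : ∀ {w} → w ∈ verts TK → tadj K v w ≡ true → EdgeNbr a b w
    nbr = edgeNbr {a} {b}

    b∈ : b ∈ L
    b∈ = proj₁ (proj₂ l)

    b≢a : b ≢ a
    b≢a = link-≢ (link-sym l)

    f-end₁ : f (vtx a) ≡ vtx b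
    f-end₁ = cong (λ c → vtx (if c then b else a)) (≡ᵇ-refl a)

    f-end₂ : f (vtx b) ≡ vtx a
    f-end₂ = cong (λ c → vtx (if c then b else a)) (≡ᵇ-false b≢a)

    f-along₁ : ∀ {x} → Link a x → f (edge (mk a x)) ≡ edge (mk a (σ x))
    f-along₁ {x} lx = cong₂ (λ c y → edge (if c then mk a (σ y) else mk b (σ (other b (mk a x)))))
      (incident⁺ {a} {mk a x} (ends-mk⁺ (inj₁ refl))) (other-mk lx)

    f-along₂ : ∀ {x} → Link b x → x ≢ a → f (edge (mk b x)) ≡ edge (mk b (σ x))
    f-along₂ {x} lx x≢a = cong₂ (λ c y → edge (if c then mk a (σ (other a (mk b x))) else mk b (σ y)))
      (incident-false {a} {mk b x} ([ (λ a≡b → b≢a (sym a≡b)) , (λ a≡x → x≢a (sym a≡x)) ] ∘ ends-mk⁻))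
      (other-mk lx)

    along₁-parity : ∀ {x} → S (edge (mk a x)) ≡ S v → χ x ≡ χ b
    along₁-parity {x} s = xor-cancelˡ (χ a) (trans (sym (S-mk a x)) (trans s (S-mk a b)))

    along₂-parity : ∀ {x} → S (edge (mk b x)) ≡ S v → χ x ≡ χ a
    along₂-parity {x} s =
      xor-cancelˡ (χ b) (trans (sym (S-mk b x)) (trans s (trans (S-mk a b) (xor-comm (χ a) (χ b)))))

    images-apart : ∀ {x y} → Link b y → χ y ≡ χ a → mk a (σ x) ≢ mk b (σ y)
    images-apart (_ , y∈ , _) χy≡χa e with ends-shared e
    ... | inj₁ a≡b  = b≢a (sym a≡b)
    ... | inj₂ a≡σy = not-¬ refl (trans (cong χ a≡σy) (trans (σ-χ y∈) (cong not χy≡χa)))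

    -- σ x is again linked to c, hence differs from c
    σ≢ : ∀ {c x} → Link c x → σ x ≢ c
    σ≢ lx = link-≢ (link-sym (link-σ lx))

    maps : ∀ {w} → SameSideNbr v w → OtherSideNbr v (f w)
    maps (w∈ , t , s) with nbr w∈ t
    ... | end₁ = subst (OtherSideNbr v) (sym f-end₁) (end-flip l s)
    ... | end₂ = subst (OtherSideNbr v) (sym f-end₂)
                   (reverse (end-flip (link-sym l) (trans s (cong (S ∘ edge) (mk-comm a b)))))
    ... | along₁ lx _ = subst (OtherSideNbr v) (sym (f-along₁ lx)) (row-flip l lx (along₁-parity s))
    ... | along₂ lx x≢a = subst (OtherSideNbr v) (sym (f-along₂ lx x≢a))
                            (reverse (row-flip (link-sym l) lx (along₂-parity s)))

    -- ... injectively (σ is injective, images at a and at b are apart) ...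
    inj : ∀ {w w'} → SameSideNbr v w → SameSideNbr v w' → f w ≡ f w' → w ≡ w'
    inj {vtx _}  {edge _} _ _ ()
    inj {edge _} {vtx _}  _ _ ()
    inj {vtx _}  {vtx _}  (w∈ , t , s) (w∈' , t' , s') e with nbr w∈ t | nbr w∈' t'
    ... | end₁ | end₁ = refl
    ... | end₂ | end₂ = refl
    ... | end₁ | end₂ = ⊥-elim (not-¬ (trans s (sym s')) (proj₂ (proj₂ l)))
    ... | end₂ | end₁ = ⊥-elim (not-¬ (trans s' (sym s)) (proj₂ (proj₂ l)))
    inj {edge _} {edge _} (w∈ , t , s) (w∈' , t' , s') e with nbr w∈ t | nbr w∈' t'
    ... | along₁ lx _ | along₁ ly _ = cong (edge ∘ mk a) (σ-inj (proj₁ (proj₂ lx)) (proj₁ (proj₂ ly))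
            (mk-injʳ (σ≢ lx) (edge-injective (≡-across (f-along₁ lx) (f-along₁ ly) e))))
    ... | along₂ lx x≢a | along₂ ly y≢a = cong (edge ∘ mk b) (σ-inj (proj₁ (proj₂ lx)) (proj₁ (proj₂ ly))
            (mk-injʳ (σ≢ lx) (edge-injective (≡-across (f-along₂ lx x≢a) (f-along₂ ly y≢a) e))))
    ... | along₁ lx _ | along₂ ly y≢a = ⊥-elim (images-apart ly (along₂-parity s')
            (edge-injective (≡-across (f-along₁ lx) (f-along₂ ly y≢a) e)))
    ... | along₂ lx x≢a | along₁ ly _ = ⊥-elim (images-apart lx (along₂-parity s)
            (edge-injective (≡-across (f-along₁ ly) (f-along₂ lx x≢a) (sym e))))

    -- ... and never onto {a , σ b}, as the along₁ neighbours avoid b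
    new : ∀ {w} → SameSideNbr v w → f w ≢ edge (mk a (σ b))
    new {vtx _}  _ ()
    new {edge _} (w∈ , t , s) e with nbr w∈ t
    ... | along₁ lx x≢b = x≢b (σ-inj (proj₁ (proj₂ lx)) b∈
            (mk-injʳ (σ≢ lx) (edge-injective (trans (sym (f-along₁ lx)) e))))
    ... | along₂ lx x≢a = images-apart lx (along₂-parity s)
            (edge-injective (trans (sym e) (f-along₂ lx x≢a)))

    balancer : Balancer v
    balancer = record { f = f ; f-maps = maps ; f-inj = inj
                      ; spare = edge (mk a (σ b)) ; spare-nbr = row-flip l l refl ; spare-new = new }

  balancerAt : ∀ {w} → w ∈ verts TK → Balancer w
  balancerAt w∈ with classify w∈
  ... | vertex x∈ = vertexBalancer x∈
  ... | edgeOf l  = EdgeBalancer.balancer l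

  totalGraph-veryCostEffective : VeryCostEffective TK
  totalGraph-veryCostEffective = balanced⇒veryCostEffective TK-unique balancerAt

odd : ℕ → Bool
odd zero    = false
odd (suc n) = not (odd n)

odd-+ : ∀ m n → odd (m + n) ≡ odd m xor odd n
odd-+ zero    n = refl
odd-+ (suc m) n = trans (cong not (odd-+ m n)) (not-distribˡ-xor (odd m) (odd n))

odd-* : ∀ m n → odd (m * n) ≡ odd m ∧ odd n
odd-* zero    n = refl
odd-* (suc m) n = begin
  odd (n + m * n)            ≡⟨ odd-+ n (m * n) ⟩
  odd n xor odd (m * n)      ≡⟨ cong (odd n xor_) (odd-* m n) ⟩
  odd n xor (odd m ∧ odd n)  ≡⟨ absorb (odd m) (odd n) ⟩
  not (odd m) ∧ odd n        ∎
  where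
    open ≡-Reasoning
    absorb : ∀ a b → b xor (a ∧ b) ≡ not a ∧ b
    absorb true  true  = refl
    absorb true  false = refl
    absorb false true  = refl
    absorb false false = refl

even⇒2∣ : ∀ n → odd n ≡ false → 2 ∣ n
even⇒2∣ zero          _ = divides 0 refl
even⇒2∣ (suc (suc n)) e = ∣m∣n⇒∣m+n (∣-refl {2}) (even⇒2∣ n (trans (sym (not-involutive (odd n))) e))

odd-prime : ∀ {r} → Prime r → 3 ≤ r → odd r ≡ true
odd-prime {r} r-prime 3≤r with odd r in e
... | true  = refl
... | false with prime⇒irreducible r-prime (even⇒2∣ r e)
...   | inj₂ refl with s≤s (s≤s ()) ← 3≤r

-- The zero-divisor graph Γ(ℤ_pq) for primes 3 ≤ p < q.  The primes are
-- given as successors so that the modulus suc (pred n) used by ZDGraph is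
-- literally n.
module ZeroDivisorGraph (p₀ q₀ : ℕ) (p-prime : Prime (suc p₀)) (q-prime : Prime (suc q₀))
                        (3≤p : 3 ≤ suc p₀) (p<q : suc p₀ < suc q₀) where

  p q n : ℕ
  p = suc p₀
  q = suc q₀
  n = p * q

  L : List ℕ
  L = verts (ZDGraph n)

  1<p : 1 < p
  1<p = ≤-trans (s≤s (s≤s z≤n)) 3≤p

  p<n : p < n
  p<n = m<m*n p q (<-trans 1<p p<q)

  q<n : q < n
  q<n = subst (q <_) (*-comm q p) (m<m*n q p 1<p)

  p∤q : ¬ p ∣ q
  p∤q p∣q with prime⇒irreducible q-prime p∣q
  ... | inj₁ p≡1 = <-irrefl (sym p≡1) 1<p
  ... | inj₂ p≡q = <-irrefl p≡q p<q

  both⇒n∣ : ∀ {x} → p ∣ x → q ∣ x → n ∣ x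
  both⇒n∣ p∣x (divides k refl) with euclidsLemma k q p-prime p∣x
  ... | inj₁ p∣k = *-monoˡ-∣ q p∣k
  ... | inj₂ p∣q = ⊥-elim (p∤q p∣q)

  n∤proper : ∀ {x} → 0 < x → x < n → ¬ n ∣ x
  n∤proper {suc _} _ x<n n∣x = <⇒≱ x<n (∣⇒≤ n∣x)

  ZeroDivisor : ℕ → Set
  ZeroDivisor x = 0 < x × x < n × (p ∣ x ⊎ q ∣ x)

  divTest⁺ : ∀ {z} → n ∣ z → (z % n ≡ᵇ 0) ≡ true
  divTest⁺ {z} d = ≡ᵇ-intro (n∣m⇒m%n≡0 z n d)

  divTest⁻ : ∀ {z} → (z % n ≡ᵇ 0) ≡ true → n ∣ z
  divTest⁻ {z} e = m%n≡0⇒n∣m z n (≡ᵇ-true⁻ e)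

  divTest-false : ∀ {z} → ¬ n ∣ z → (z % n ≡ᵇ 0) ≡ false
  divTest-false {z} n∤z = ≡ᵇ-false (n∤z ∘ m%n≡0⇒n∣m z n)

  positive⁺ : ∀ {x} → 0 < x → not (x ≡ᵇ 0) ≡ true
  positive⁺ {suc _} _ = refl

  positive⁻ : ∀ {x} → not (x ≡ᵇ 0) ≡ true → 0 < x
  positive⁻ {suc _} _ = s≤s z≤n

  annihilated⇒multiple : ∀ {x y} → 0 < y → y < n → n ∣ x * y → p ∣ x ⊎ q ∣ x
  annihilated⇒multiple {x} {y} 0<y y<n n∣xy
    with euclidsLemma x y p-prime (m*n∣⇒m∣ p q n∣xy) | euclidsLemma x y q-prime (m*n∣⇒n∣ p q n∣xy)
  ... | inj₁ p∣x | _        = inj₁ p∣x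
  ... | inj₂ _   | inj₁ q∣x = inj₂ q∣x
  ... | inj₂ p∣y | inj₂ q∣y = ⊥-elim (n∤proper 0<y y<n (both⇒n∣ p∣y q∣y))

  multiple⇒annihilated : ∀ {x} → p ∣ x ⊎ q ∣ x → ∃ λ y → 0 < y × y < n × n ∣ x * y
  multiple⇒annihilated (inj₁ p∣x) = q , s≤s z≤n , q<n , *-pres-∣ p∣x (∣-refl {q})
  multiple⇒annihilated {x} (inj₂ q∣x) = p , s≤s z≤n , p<n , subst (n ∣_) (*-comm p x) (*-pres-∣ (∣-refl {p}) q∣x)

  annihilates : ℕ → ℕ → Bool
  annihilates x y = not (y ≡ᵇ 0) ∧ ((x * y) % n ≡ᵇ 0)

  ∈L⁻ : ∀ {x} → x ∈ L → ZeroDivisor x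
  ∈L⁻ {x} x∈ with ∈-bfilter⁻ (isZeroDivisor n) x∈
  ... | x∈upTo , zd with find (any⁻ (annihilates x) (upTo n) (≡true⇒T (∧-conicalʳ (not (x ≡ᵇ 0)) _ zd)))
  ...   | y , y∈upTo , Ty = positive⁻ (∧-conicalˡ _ _ zd) , ∈-upTo⁻ x∈upTo ,
          annihilated⇒multiple (positive⁻ (∧-conicalˡ _ _ test)) (∈-upTo⁻ y∈upTo)
                               (divTest⁻ (∧-conicalʳ (not (y ≡ᵇ 0)) _ test))
    where
      test : annihilates x y ≡ true
      test = T⇒≡true Ty

  ∈L⁺ : ∀ {x} → ZeroDivisor x → x ∈ L
  ∈L⁺ {x} (0<x , x<n , multiple) with multiple⇒annihilated multiple
  ... | y , 0<y , y<n , n∣xy = ∈-bfilter⁺ (isZeroDivisor n) (∈-upTo⁺ x<n)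
        (∧-intro (positive⁺ 0<x) (T⇒≡true (any⁺ (annihilates x) (lose (∈-upTo⁺ y<n)
          (≡true⇒T (∧-intro (positive⁺ 0<y) (divTest⁺ n∣xy)))))))

  L-sorted : AllPairs _<_ L
  L-sorted = bfilter-AllPairs (isZeroDivisor n) (AllPairsₚ.applyUpTo⁺₁ (λ i → i) n (λ i<j _ → i<j))

  data Part (x : ℕ) : Set where
    p-part : p ∣ x → ¬ q ∣ x → Part x
    q-part : q ∣ x → ¬ p ∣ x → Part x

  part : ∀ {x} → x ∈ L → Part x
  part x∈ with ∈L⁻ x∈
  ... | 0<x , x<n , inj₁ p∣x = p-part p∣x (λ q∣x → n∤proper 0<x x<n (both⇒n∣ p∣x q∣x))
  ... | 0<x , x<n , inj₂ q∣x = q-part q∣x (λ p∣x → n∤proper 0<x x<n (both⇒n∣ p∣x q∣x))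

  side : ℕ → Bool
  side x = does (p ∣? x)

  side-resp : ∀ {x y} → (p ∣ x → p ∣ y) → (p ∣ y → p ∣ x) → side x ≡ side y
  side-resp {x} {y} x⇒y y⇒x with p ∣? x
  ... | yes p∣x = trans (dec-true (p ∣? x) p∣x) (sym (dec-true (p ∣? y) (x⇒y p∣x)))
  ... | no  p∤x = trans (dec-false (p ∣? x) p∤x) (sym (dec-false (p ∣? y) (p∤x ∘ y⇒x)))

  adjacent : ∀ {x y} → x ≢ y → n ∣ x * y → adj (ZDGraph n) x y ≡ true
  adjacent x≢y n∣xy = cong₂ (λ c t → not c ∧ t) (≡ᵇ-false x≢y) (divTest⁺ n∣xy)

  nonadjacent : ∀ {x y} → ¬ n ∣ x * y → adj (ZDGraph n) x y ≡ false
  nonadjacent {x} {y} n∤xy = trans (cong (not (x ≡ᵇ y) ∧_) (divTest-false n∤xy)) (∧-zeroʳ _)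

  adj-side : ∀ {x y} → x ∈ L → y ∈ L → adj (ZDGraph n) x y ≡ side x xor side y
  adj-side {x} {y} x∈ y∈ with part x∈ | part y∈
  ... | p-part p∣x _ | q-part q∣y p∤y =
        trans (adjacent {x} {y} (λ { refl → p∤y p∣x }) (*-pres-∣ p∣x q∣y))
              (sym (cong₂ _xor_ (dec-true (p ∣? x) p∣x) (dec-false (p ∣? y) p∤y)))
  ... | q-part q∣x p∤x | p-part p∣y _ =
        trans (adjacent {x} {y} (λ { refl → p∤x p∣y }) (subst (n ∣_) (*-comm y x) (*-pres-∣ p∣y q∣x)))
              (sym (cong₂ _xor_ (dec-false (p ∣? x) p∤x) (dec-true (p ∣? y) p∣y)))
  ... | p-part p∣x q∤x | p-part p∣y q∤y =
        trans (nonadjacent {x} {y} (λ n∣xy → [ q∤x , q∤y ] (euclidsLemma x y q-prime (m*n∣⇒n∣ p q n∣xy))))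
              (sym (cong₂ _xor_ (dec-true (p ∣? x) p∣x) (dec-true (p ∣? y) p∣y)))
  ... | q-part _ p∤x | q-part _ p∤y =
        trans (nonadjacent {x} {y} (λ n∣xy → [ p∤x , p∤y ] (euclidsLemma x y p-prime (m*n∣⇒m∣ p q n∣xy))))
              (sym (cong₂ _xor_ (dec-false (p ∣? x) p∤x) (dec-false (p ∣? y) p∤y)))

  complement : ∀ {d x} → d ∣ n → x ≤ n → d ∣ x → d ∣ n ∸ x
  complement {d} {x} d∣n x≤n d∣x = ∣m+n∣m⇒∣n (subst (d ∣_) (sym (m+[n∸m]≡n x≤n)) d∣n) d∣x

  complement⁻ : ∀ {d x} → d ∣ n → x ≤ n → d ∣ n ∸ x → d ∣ x
  complement⁻ {d} {x} d∣n x≤n d∣n∸x = subst (d ∣_) (m∸[m∸n]≡n x≤n) (complement d∣n (m∸n≤m n x) d∣n∸x)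

  ∈L⇒≤ : ∀ {x} → x ∈ L → x ≤ n
  ∈L⇒≤ x∈ = <⇒≤ (proj₁ (proj₂ (∈L⁻ x∈)))

  σ-∈ : ∀ {x} → x ∈ L → n ∸ x ∈ L
  σ-∈ x∈ with ∈L⁻ x∈
  ... | 0<x , x<n , multiple = ∈L⁺ (m<n⇒0<n∸m x<n , ∸-monoʳ-< 0<x (<⇒≤ x<n) ,
          map⊎ (complement (m∣m*n q) (<⇒≤ x<n)) (complement (n∣m*n p) (<⇒≤ x<n)) multiple)

  σ-side : ∀ {x} → x ∈ L → side (n ∸ x) ≡ side x
  σ-side {x} x∈ = side-resp (complement⁻ (m∣m*n q) x≤n) (complement (m∣m*n q) x≤n)
    where
      x≤n : x ≤ n
      x≤n = ∈L⇒≤ x∈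

  σ-odd : ∀ {x} → x ∈ L → odd (n ∸ x) ≡ not (odd x)
  σ-odd {x} x∈ = xor-true (begin
    odd (n ∸ x) xor odd x  ≡⟨ sym (odd-+ (n ∸ x) x) ⟩
    odd (n ∸ x + x)        ≡⟨ cong odd (m∸n+n≡m (∈L⇒≤ x∈)) ⟩
    odd (p * q)            ≡⟨ odd-* p q ⟩
    odd p ∧ odd q          ≡⟨ cong₂ _∧_ (odd-prime p-prime 3≤p) (odd-prime q-prime (≤-trans 3≤p (<⇒≤ p<q))) ⟩
    true                   ∎)
    where open ≡-Reasoning

  σ-inj : ∀ {x y} → x ∈ L → y ∈ L → n ∸ x ≡ n ∸ y → x ≡ y
  σ-inj x∈ y∈ = ∸-cancelˡ-≡ (∈L⇒≤ x∈) (∈L⇒≤ y∈)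

  -- both parts are nonempty: p and q are zero-divisors
  opposite : ∀ {x} → x ∈ L → ∃ λ y → y ∈ L × side y ≡ not (side x)
  opposite {x} x∈ with part x∈
  ... | p-part p∣x _ = q , ∈L⁺ (s≤s z≤n , q<n , inj₂ (∣-refl {q})) ,
                       trans (dec-false (p ∣? q) p∤q) (cong not (sym (dec-true (p ∣? x) p∣x)))
  ... | q-part _ p∤x = p , ∈L⁺ (s≤s z≤n , p<n , inj₁ (∣-refl {p})) ,
                       trans (dec-true (p ∣? p) ∣-refl) (cong not (sym (dec-false (p ∣? x) p∤x)))

  open CompleteBipartite L L-sorted (adj (ZDGraph n)) side adj-side odd (n ∸_)
                         σ-∈ σ-side σ-odd σ-inj opposite
    using (totalGraph-veryCostEffective)

  -- Γ(ℤ_n) is literally the graph K of the complete bipartite development.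
  total-veryCostEffective : VeryCostEffective (Total (ZDGraph n))
  total-veryCostEffective = totalGraph-veryCostEffective

mainTheorem9 : (p q : ℕ) → Prime p → Prime q → 3 ≤ p → p < q →
    VeryCostEffective (Total (ZDGraph (p * q)))
mainTheorem9 (suc p₀) (suc q₀) p-prime q-prime 3≤p p<q =
  ZeroDivisorGraph.total-veryCostEffective p₀ q₀ p-prime q-prime 3≤p p<q
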